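{- Let $n\ge1$ and define $\phi:\mathcal{B}_{2n}\to\mathcal{B}_{2n}$ as follows. Given $p\in\mathcal{B}_{2n}$, let $s=(s_1,\dots,s_{2n})$ be its word, with $s_j$ an arrow if the $j$-th step is an up-step and a blank if it is a down-step. Let $s_{NW}$ be the length-$n$ sequence obtained from $(s_1,s_3,\dots,s_{2n-1})$ by replacing every arrow by a blank and every blank by an arrow, and let $s_{SW}=(s_2,s_4,\dots,s_{2n-2})$ (the even-indexed entries with the last one removed). Then $(s_{NW},s_{SW})$ is a checkmark pair, and $\phi(p)$ is defined to be the unique path in $\mathcal{B}_{2n}$ whose checkmark representation is $(s_{NW},s_{SW})$. Then $\phi$ is a bijection. Furthermore, if $p$ has bi-banded weight $w(p)=a^{2n-2v}b^{2v}$, then $\phi(p)$ has peak-counting weight $\widehat{w}(\phi(p))=m^{v+1}$.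
   Context: A path of length $t$ is a sequence of vertices $v_0,\dots,v_t$ in $\mathbb{Z}^2$ with $v_0=(0,0)$, $v_t=(t,0)$ and each step $v_j-v_{j-1}\in\{(1,1),(1,-1)\}$ (up-step / down-step). $\mathcal{B}_{2n}$ is the set of all such paths of length $2n$ with vertices in $\mathbb{Z}_{\ge0}\times\mathbb{Z}$. A right turn of $p$ is a vertex $v_i$ ($0\le i<2n$) at which an up-step is followed by a down-step, where $v_0$ counts as a right turn iff the first step is a down-step; a left turn is a vertex $v_i$ ($0<i<2n$) at which a down-step is followed by an up-step. The checkmark representation of $p\in\mathcal{B}_{2n}$ is the pair $(s_{NW},s_{SW})$ of arrow/blank sequences of lengths $n$ and $n-1$ where the $h$-th entry of $s_{NW}$ ($1\le h\le n$) is an arrow iff $p$ has a right turn at a vertex $(i,y)$ with $i+y=2(h-1)$, and the $j$-th entry of $s_{SW}$ ($1\le j\le n-1$) is an arrow iff $p$ has a left turn at a vertex $(i,y)$ with $i-y=2j$. A checkmark pair is a pair of such sequences in which the number of arrows of $s_{NW}$ equals or exceeds by one that of $s_{SW}$; every checkmark pair is the checkmark representation of exactly one path in $\mathcal{B}_{2n}$. Bi-banded weight: an up-step from an even height to an odd height, and a down-step from an odd height to an even height, get weight $a$; every other step gets weight $b$; $w(p)$ is the product of the step weights. Peak-counting weight: a peak is a vertex $v_i$ with $0<i<2n$ preceded by an up-step and followed by a down-step; additionally $v_0$ is a peak iff the first step is a down-step, and $v_{2n}$ is a peak iff the last step is an up-step; $\widehat{w}(p)=m^{\#\text{peaks of }p}$.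 -}

module Defs where

open import Data.Bool using (Bool; true; false; not; _∧_; if_then_else_)
open import Data.Nat using (ℕ; zero; suc; _+_; _*_; _∸_; _<_; _≤_; _%_)
open import Data.Nat.Properties using (*-monoʳ-<; *-monoʳ-≤; *-suc; ≤-trans; m∸n≤m)
open import Data.Integer as ℤ using (ℤ; +_; ∣_∣)
open import Data.Fin using (Fin; toℕ; fromℕ<)
open import Data.Fin.Properties using (toℕ<n)
open import Data.Vec using (Vec; []; _∷_; lookup; tabulate; toList)
open import Data.List using (List) renaming ([] to []ˡ; _∷_ to _∷ˡ_)
open import Data.Maybe using (Maybe; just; nothing)
open import Data.Product using (Σ; _×_; _,_; ∃)
open import Data.Sum using (_⊎_)
open import Relation.Binary.PropositionalEquality using (_≡_; subst)

-- Steps are encoded as Booleans: true = up-step (1,1) = arrow,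
-- false = down-step (1,-1) = blank.

δ : Bool → ℤ
δ true  = + 1
δ false = ℤ.- (+ 1)

-- height y of the vertex v_i = (i , y) of the path with word w
-- (only meaningful for i ≤ length of w)
height : ∀ {m} → Vec Bool m → ℕ → ℤ
height _        zero    = + 0
height []       (suc i) = + 0
height (x ∷ xs) (suc i) = δ x ℤ.+ height xs i

-- the (j+1)-th step of the word (0-based index j), if it exists
nth : ∀ {m} → Vec Bool m → ℕ → Maybe Bool
nth []       _       = nothing
nth (x ∷ _)  zero    = just x
nth (_ ∷ xs) (suc j) = nth xs j

record Path (n : ℕ) : Set where
  constructor path
  field
    word   : Vec Bool (2 * n)
    closed : height word (2 * n) ≡ + 0
open Path public

RightTurn : ∀ {m} → Vec Bool m → ℕ → Set
RightTurn w i = nth w i ≡ just false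
              × (i ≡ 0 ⊎ Σ ℕ (λ j → i ≡ suc j × nth w j ≡ just true))

LeftTurn : ∀ {m} → Vec Bool m → ℕ → Set
LeftTurn w i = Σ ℕ (λ j → i ≡ suc j × nth w j ≡ just false × nth w i ≡ just true)

arrows : ∀ {k} → Vec Bool k → ℕ
arrows []           = 0
arrows (true ∷ xs)  = suc (arrows xs)
arrows (false ∷ xs) = arrows xs

CheckmarkPair : ∀ {n} → Vec Bool n → Vec Bool (n ∸ 1) → Set
CheckmarkPair a b = arrows a ≡ arrows b ⊎ arrows a ≡ suc (arrows b)

-- (sNW , sSW) is the checkmark representation of p.
-- Entry h = k+1 of sNW (k : Fin n) is an arrow iff p has a right turn at a
-- vertex (i,y) with i + y = 2(h-1) = 2k; entry j = k+1 of sSW (k : Fin (n-1))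
-- is an arrow iff p has a left turn at a vertex (i,y) with i - y = 2j.
IsCheckmarkRep : ∀ {n} → Path n → Vec Bool n → Vec Bool (n ∸ 1) → Set
IsCheckmarkRep {n} p sNW sSW =
  (∀ (k : Fin n) →
     (lookup sNW k ≡ true →
        ∃ λ i → RightTurn (word p) i × (+ i ℤ.+ height (word p) i ≡ + (2 * toℕ k)))
   × ((∃ λ i → RightTurn (word p) i × (+ i ℤ.+ height (word p) i ≡ + (2 * toℕ k)))
        → lookup sNW k ≡ true))
  ×
  (∀ (k : Fin (n ∸ 1)) →
     (lookup sSW k ≡ true →
        ∃ λ i → LeftTurn (word p) i × (+ i ℤ.- height (word p) i ≡ + (2 * suc (toℕ k))))
   × ((∃ λ i → LeftTurn (word p) i × (+ i ℤ.- height (word p) i ≡ + (2 * suc (toℕ k))))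
        → lookup sSW k ≡ true))

-- index 2k (0-based), i.e. the step s_{2k+1}
evenIx : ∀ {n} → Fin n → Fin (2 * n)
evenIx {n} k = fromℕ< {2 * toℕ k} (*-monoʳ-< 2 (toℕ<n k))

-- index 2k+1 (0-based), i.e. the step s_{2k+2}, for k < n - 1
oddIx : ∀ {n} → Fin (n ∸ 1) → Fin (2 * n)
oddIx {n} k = fromℕ< {suc (2 * toℕ k)}
  (subst (_≤ 2 * n) (*-suc 2 (toℕ k))
         (*-monoʳ-≤ 2 (≤-trans (toℕ<n k) (m∸n≤m n 1))))

sNW : ∀ {n} → Path n → Vec Bool n
sNW p = tabulate (λ k → not (lookup (word p) (evenIx k)))

sSW : ∀ {n} → Path n → Vec Bool (n ∸ 1)
sSW {n} p = tabulate (λ k → lookup (word p) (oddIx {n} k))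

isEven : ℤ → Bool
isEven z with ∣ z ∣ % 2
... | zero  = true
... | suc _ = false

-- exponents (of a, of b) of the bi-banded weight of a word starting at height h:
-- up-step even→odd and down-step odd→even get weight a, all others weight b.
biBandedFrom : ℤ → List Bool → ℕ × ℕ
biBandedFrom h []ˡ = 0 , 0
biBandedFrom h (true ∷ˡ xs) with biBandedFrom (h ℤ.+ + 1) xs | isEven h
... | (x , y) | true  = suc x , y
... | (x , y) | false = x , suc y
biBandedFrom h (false ∷ˡ xs) with biBandedFrom (h ℤ.- + 1) xs | isEven h
... | (x , y) | true  = x , suc y
... | (x , y) | false = suc x , y

biBanded : ∀ {n} → Path n → ℕ × ℕ
biBanded p = biBandedFrom (+ 0) (toList (word p))

interiorPeaks : List Bool → ℕ
interiorPeaks (x ∷ˡ y ∷ˡ r) = (if x ∧ not y then 1 else 0) + interiorPeaks (y ∷ˡ r)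
interiorPeaks _ = 0

firstDown : List Bool → ℕ
firstDown (false ∷ˡ _) = 1
firstDown _ = 0

lastUp : List Bool → ℕ
lastUp []ˡ = 0
lastUp (x ∷ˡ []ˡ) = if x then 1 else 0
lastUp (_ ∷ˡ y ∷ˡ r) = lastUp (y ∷ˡ r)

-- number of peaks (including v_0 if the first step is down and v_{2n} if the
-- last step is up); the peak-counting weight is m ^ peaks p
peaks : ∀ {n} → Path n → ℕ
peaks p = firstDown w + interiorPeaks w + lastUp w
  where w = toList (word p)

-- A path is determined by its turns.  Reading its word from the left, the step after the k-th
-- up-step (the first step, for k = 0) is a down-step exactly when the path has a right turn at
-- a vertex with i + y = 2k, and the step after the j-th down-step is an up-step exactly when it
-- has a left turn with i − y = 2j; once all n up-steps or all n down-steps are used, the rest is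
-- forced.  Right and left turns alternate, so the turn data of a path is a checkmark pair, and
-- conversely every checkmark pair drives this reading to a path in B_2n.  Hence the checkmark
-- representation is a bijection onto checkmark pairs, and a path whose NW sequence has v arrows
-- has v + 1 peaks.  The map p ↦ (s_NW, s_SW) forgets only the last step, which the number of
-- up-steps fixes, and interleaving shows that it also hits every checkmark pair; so φ is a
-- bijection.  Finally, as the height of v_i has the parity of i, the b-steps of p are its
-- down-steps at odd positions, counted by the arrows of s_NW, and its up-steps at even
-- positions, which are equally many because p has n up-steps; so w(p) = a^(2n−2v) b^(2v)
-- means that s_NW has v arrows.

module Submission where

open import Axiom.UniquenessOfIdentityProofs using (module Decidable⇒UIP)
open import Data.Bool using (Bool; true; false; not; _∧_; _∨_; _xor_; if_then_else_)
open import Data.Bool.Properties using (∧-zeroʳ; ∨-zeroʳ; not-involutive; not-injective; ⇔→≡)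
open import Data.Empty using (⊥-elim)
open import Data.Fin using (Fin; toℕ; fromℕ<)
open import Data.Fin.Properties using (toℕ-fromℕ<; toℕ<n)
open import Data.Integer as ℤ using (ℤ; +_; -[1+_]; ∣_∣)
import Data.Integer.Properties as ℤ
import Data.Integer.Tactic.RingSolver as ℤ-Solver
open import Data.List using (List; []; _∷_; length; replicate; take; _++_; [_])
open import Data.List.Properties using (take-all)
open import Data.Maybe using (just)
open import Data.Maybe.Properties using (just-injective)
open import Data.Nat using (ℕ; zero; suc; _+_; _*_; _∸_; _≤_; _<_; _≡ᵇ_; _%_; s≤s; z≤n; s≤s⁻¹)
open import Data.Nat.Properties
import Data.Nat.Tactic.RingSolver as ℕ-Solver
open import Data.Product as Prod using (Σ; _×_; _,_; proj₁; proj₂; ∃)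
open import Data.Sum as Sum using (_⊎_; inj₁; inj₂; map₁)
open import Data.Vec as Vec using (Vec; []; _∷_; toList; lookup; tabulate)
open import Data.Vec.Properties
  using (lookup∘tabulate; length-toList; toList-injective; cast-is-id; toList∘fromList;
         tabulate∘lookup; tabulate-cong)
open import Function.Bundles using (_⇔_; mk⇔; Equivalence)
open import Function.Consequences.Propositional using (strictlySurjective⇒surjective)
open import Function.Definitions using (Bijective; Injective; StrictlySurjective)
import Function.Properties.Equivalence as ⇔
open import Relation.Binary.PropositionalEquality hiding ([_])

open import Defs

bit : Bool → ℕ
bit true  = 1
bit false = 0

ups : List Bool → ℕ
ups []       = 0
ups (x ∷ xs) = bit x + ups xs

downs : List Bool → ℕ
downs []       = 0
downs (x ∷ xs) = bit (not x) + downs xs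

≡+bit⇒⊎ : ∀ {a b} x → a ≡ b + bit x → a ≡ b ⊎ a ≡ suc b
≡+bit⇒⊎ {b = b} true  e = inj₂ (trans e (+-comm b 1))
≡+bit⇒⊎ {b = b} false e = inj₁ (trans e (+-identityʳ b))

⊎⇒≡+bit : ∀ {a b} → a ≡ b ⊎ a ≡ suc b → ∃ λ z → a ≡ b + bit z
⊎⇒≡+bit {b = b} (inj₁ e) = false , trans e (sym (+-identityʳ b))
⊎⇒≡+bit {b = b} (inj₂ e) = true  , trans e (+-comm 1 b)

ups-++ : ∀ xs ys → ups (xs ++ ys) ≡ ups xs + ups ys
ups-++ []       ys = refl
ups-++ (x ∷ xs) ys = trans (cong (_+_ (bit x)) (ups-++ xs ys)) (sym (+-assoc (bit x) _ _))

ups-∷ʳ : ∀ xs x → ups (xs ++ [ x ]) ≡ ups xs + bit x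
ups-∷ʳ xs x = trans (ups-++ xs [ x ]) (cong (_+_ (ups xs)) (+-identityʳ (bit x)))

length≡ups+downs : ∀ xs → length xs ≡ ups xs + downs xs
length≡ups+downs []           = refl
length≡ups+downs (true ∷ xs)  = cong suc (length≡ups+downs xs)
length≡ups+downs (false ∷ xs) = trans (cong suc (length≡ups+downs xs)) (sym (+-suc (ups xs) _))

arrows≡ups : ∀ {m} (v : Vec Bool m) → arrows v ≡ ups (toList v)
arrows≡ups []          = refl
arrows≡ups (true ∷ v)  = cong suc (arrows≡ups v)
arrows≡ups (false ∷ v) = arrows≡ups v

ups-replicate-true : ∀ m → ups (replicate m true) ≡ m
ups-replicate-true zero    = refl
ups-replicate-true (suc m) = cong suc (ups-replicate-true m)

ups-replicate-false : ∀ m → ups (replicate m false) ≡ 0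
ups-replicate-false zero    = refl
ups-replicate-false (suc m) = ups-replicate-false m

downs-replicate-true : ∀ m → downs (replicate m true) ≡ 0
downs-replicate-true zero    = refl
downs-replicate-true (suc m) = downs-replicate-true m

downs-replicate-false : ∀ m → downs (replicate m false) ≡ m
downs-replicate-false zero    = refl
downs-replicate-false (suc m) = cong suc (downs-replicate-false m)

ups≡0⇒replicate : ∀ xs → ups xs ≡ 0 → xs ≡ replicate (downs xs) false
ups≡0⇒replicate []           _ = refl
ups≡0⇒replicate (false ∷ xs) e = cong (false ∷_) (ups≡0⇒replicate xs e)

downs≡0⇒replicate : ∀ xs → downs xs ≡ 0 → xs ≡ replicate (ups xs) true
downs≡0⇒replicate []          _ = refl
downs≡0⇒replicate (true ∷ xs) e = cong (true ∷_) (downs≡0⇒replicate xs e)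

stepAt : List Bool → ℕ → Bool
stepAt []       _       = false
stepAt (x ∷ xs) zero    = x
stepAt (x ∷ xs) (suc k) = stepAt xs k

ups≡0⇒stepAt≡false : ∀ xs j → ups xs ≡ 0 → stepAt xs j ≡ false
ups≡0⇒stepAt≡false []           j       _ = refl
ups≡0⇒stepAt≡false (false ∷ xs) zero    _ = refl
ups≡0⇒stepAt≡false (false ∷ xs) (suc j) e = ups≡0⇒stepAt≡false xs j e

slice : ∀ {A : Set} → (ℕ → A) → ℕ → ℕ → List A
slice f s zero    = []
slice f s (suc c) = f s ∷ slice f (suc s) c

slice-cong : ∀ {A : Set} (f g : ℕ → A) s c → (∀ k → s ≤ k → f k ≡ g k) → slice f s c ≡ slice g s c
slice-cong f g s zero    _ = refl
slice-cong f g s (suc c) h = cong₂ _∷_ (h s ≤-refl) (slice-cong f g (suc s) c (λ k sk → h k (<⇒≤ sk)))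

length-slice : ∀ {A : Set} (f : ℕ → A) s c → length (slice f s c) ≡ c
length-slice f s zero    = refl
length-slice f s (suc c) = cong suc (length-slice f (suc s) c)

slice-suc : ∀ {A : Set} (f : ℕ → A) s c → slice f (suc s) c ≡ slice (λ j → f (suc j)) s c
slice-suc f s zero    = refl
slice-suc f s (suc c) = cong (f (suc s) ∷_) (slice-suc f (suc s) c)

slice-∷ʳ : ∀ {A : Set} (f : ℕ → A) s c → slice f s (suc c) ≡ slice f s c ++ [ f (s + c) ]
slice-∷ʳ f s zero    = cong [_] (cong f (sym (+-identityʳ s)))
slice-∷ʳ f s (suc c) = cong (f s ∷_) (trans (slice-∷ʳ f (suc s) c)
                                             (cong (λ z → slice f (suc s) c ++ [ f z ]) (sym (+-suc s c))))

ups-slice-false : ∀ f s c → (∀ k → f k ≡ false) → ups (slice f s c) ≡ 0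
ups-slice-false f s zero    _ = refl
ups-slice-false f s (suc c) h rewrite h s = ups-slice-false f (suc s) c h

lookup≡stepAt : ∀ {m} (v : Vec Bool m) (i : Fin m) → lookup v i ≡ stepAt (toList v) (toℕ i)
lookup≡stepAt (x ∷ v) Fin.zero    = refl
lookup≡stepAt (x ∷ v) (Fin.suc i) = lookup≡stepAt v i

toList≡slice : ∀ {A : Set} {c} (v : Vec A c) f s →
               (∀ k → lookup v k ≡ f (s + toℕ k)) → toList v ≡ slice f s c
toList≡slice []      f s _ = refl
toList≡slice (x ∷ v) f s h = cong₂ _∷_ (trans (h Fin.zero) (cong f (+-identityʳ s)))
  (toList≡slice v f (suc s) (λ k → trans (h (Fin.suc k)) (cong f (+-suc s (toℕ k)))))

toℕ<length-toList : ∀ {A : Set} {m} (v : Vec A m) (k : Fin m) → toℕ k < length (toList v)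
toℕ<length-toList v k = subst (toℕ k <_) (sym (length-toList v)) (toℕ<n k)

lookup-ext : ∀ {A : Set} {n} (xs ys : Vec A n) → (∀ i → lookup xs i ≡ lookup ys i) → xs ≡ ys
lookup-ext xs ys eq = trans (sym (tabulate∘lookup xs)) (trans (tabulate-cong eq) (tabulate∘lookup ys))

toList-subst : ∀ {A : Set} {m n} (eq : m ≡ n) (v : Vec A m) → toList (subst (Vec A) eq v) ≡ toList v
toList-subst refl v = refl

fromList′ : ∀ {A : Set} {n} (xs : List A) → length xs ≡ n → Vec A n
fromList′ {A} xs len = subst (Vec A) len (Vec.fromList xs)

toList-fromList′ : ∀ {A : Set} {n} (xs : List A) (len : length xs ≡ n) → toList (fromList′ xs len) ≡ xs
toList-fromList′ xs len = trans (toList-subst len (Vec.fromList xs)) (toList∘fromList xs)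

-- Heights

2*n+2≡2*[1+n] : ∀ n → 2 * n + 2 ≡ 2 * suc n
2*n+2≡2*[1+n] n = trans (+-comm (2 * n) 2) (sym (*-suc 2 n))

i+height≡2*ups : ∀ {m} (w : Vec Bool m) i → i ≤ m →
                 + i ℤ.+ height w i ≡ + (2 * ups (take i (toList w)))
i+height≡2*ups w          zero    _         = refl
i+height≡2*ups (true ∷ w) (suc i) (s≤s i≤m) = begin
  + suc i ℤ.+ (+ 1 ℤ.+ height w i)          ≡⟨ regroup (+ i) (height w i) ⟩
  (+ i ℤ.+ height w i) ℤ.+ + 2              ≡⟨ cong (ℤ._+ + 2) (i+height≡2*ups w i i≤m) ⟩
  + (2 * ups (take i (toList w)) + 2)       ≡⟨ cong +_ (2*n+2≡2*[1+n] _) ⟩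
  + (2 * suc (ups (take i (toList w))))     ∎
  where
  open ≡-Reasoning
  regroup : ∀ a h → (+ 1 ℤ.+ a) ℤ.+ (+ 1 ℤ.+ h) ≡ (a ℤ.+ h) ℤ.+ + 2
  regroup = ℤ-Solver.solve-∀
i+height≡2*ups (false ∷ w) (suc i) (s≤s i≤m) =
  trans (cancel (+ i) (height w i)) (i+height≡2*ups w i i≤m)
  where
  cancel : ∀ a h → (+ 1 ℤ.+ a) ℤ.+ (ℤ.- (+ 1) ℤ.+ h) ≡ a ℤ.+ h
  cancel = ℤ-Solver.solve-∀

i-height≡2*downs : ∀ {m} (w : Vec Bool m) i → i ≤ m →
                   + i ℤ.- height w i ≡ + (2 * downs (take i (toList w)))
i-height≡2*downs w          zero    _         = refl
i-height≡2*downs (true ∷ w) (suc i) (s≤s i≤m) =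
  trans (cancel (+ i) (height w i)) (i-height≡2*downs w i i≤m)
  where
  cancel : ∀ a h → (+ 1 ℤ.+ a) ℤ.- (+ 1 ℤ.+ h) ≡ a ℤ.- h
  cancel = ℤ-Solver.solve-∀
i-height≡2*downs (false ∷ w) (suc i) (s≤s i≤m) = begin
  + suc i ℤ.- (ℤ.- (+ 1) ℤ.+ height w i)    ≡⟨ regroup (+ i) (height w i) ⟩
  (+ i ℤ.- height w i) ℤ.+ + 2              ≡⟨ cong (ℤ._+ + 2) (i-height≡2*downs w i i≤m) ⟩
  + (2 * downs (take i (toList w)) + 2)     ≡⟨ cong +_ (2*n+2≡2*[1+n] _) ⟩
  + (2 * suc (downs (take i (toList w))))   ∎
  where
  open ≡-Reasoning
  regroup : ∀ a h → (+ 1 ℤ.+ a) ℤ.- (ℤ.- (+ 1) ℤ.+ h) ≡ (a ℤ.- h) ℤ.+ + 2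
  regroup = ℤ-Solver.solve-∀

closed⇔ups≡n : ∀ n (w : Vec Bool (2 * n)) → height w (2 * n) ≡ + 0 ⇔ ups (toList w) ≡ n
closed⇔ups≡n n w = mk⇔ to from
  where
  U = ups (toList w)
  total : + (2 * n) ℤ.+ height w (2 * n) ≡ + (2 * U)
  total = trans (i+height≡2*ups w (2 * n) ≤-refl)
                (cong (λ xs → + (2 * ups xs)) (take-all (2 * n) (toList w) (≤-reflexive (length-toList w))))
  to : height w (2 * n) ≡ + 0 → U ≡ n
  to h = *-cancelˡ-≡ U n 2 (ℤ.+-injective (sym (begin
    + (2 * n)                         ≡⟨ ℤ.+-identityʳ (+ (2 * n)) ⟨
    + (2 * n) ℤ.+ + 0                 ≡⟨ cong (ℤ._+_ (+ (2 * n))) h ⟨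
    + (2 * n) ℤ.+ height w (2 * n)    ≡⟨ total ⟩
    + (2 * U)                         ∎)))
    where open ≡-Reasoning
  from : U ≡ n → height w (2 * n) ≡ + 0
  from e = begin
    height w (2 * n)                                ≡⟨ unshift (+ (2 * n)) (height w (2 * n)) ⟩
    (+ (2 * n) ℤ.+ height w (2 * n)) ℤ.- + (2 * n)  ≡⟨ cong (ℤ._- + (2 * n)) total ⟩
    + (2 * U) ℤ.- + (2 * n)                         ≡⟨ cong (λ u → + (2 * u) ℤ.- + (2 * n)) e ⟩
    + (2 * n) ℤ.- + (2 * n)                         ≡⟨ ℤ.+-inverseʳ (+ (2 * n)) ⟩
    + 0                                             ∎
    where
    open ≡-Reasoning
    unshift : ∀ a h → h ≡ (a ℤ.+ h) ℤ.- a
    unshift = ℤ-Solver.solve-∀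

-- Right and left turns

≡ᵇ-refl : ∀ m → (m ≡ᵇ m) ≡ true
≡ᵇ-refl zero    = refl
≡ᵇ-refl (suc m) = ≡ᵇ-refl m

≢⇒≡ᵇ≡false : ∀ m n → m ≢ n → (m ≡ᵇ n) ≡ false
≢⇒≡ᵇ≡false zero    zero    m≢n = ⊥-elim (m≢n refl)
≢⇒≡ᵇ≡false zero    (suc n) _   = refl
≢⇒≡ᵇ≡false (suc m) zero    _   = refl
≢⇒≡ᵇ≡false (suc m) (suc n) m≢n = ≢⇒≡ᵇ≡false m n (λ e → m≢n (cong suc e))

≡ᵇ≡true⇒≡ : ∀ m n → (m ≡ᵇ n) ≡ true → m ≡ n
≡ᵇ≡true⇒≡ zero    zero    _ = refl
≡ᵇ≡true⇒≡ (suc m) (suc n) e = cong suc (≡ᵇ≡true⇒≡ m n e)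

-- In rightTurnAt, leftTurnAt and peaksAfter the flag p says whether the step before the
-- scanned word is an up-step, the origin counting as one (as for RightTurn and peaks at v₀);
-- u and d are the numbers of up- and down-steps already taken.
rightTurnAt : Bool → ℕ → List Bool → ℕ → Bool
rightTurnAt p u []          k = false
rightTurnAt p u (false ∷ w) k = (p ∧ (u ≡ᵇ k)) ∨ rightTurnAt false u w k
rightTurnAt p u (true ∷ w)  k = rightTurnAt true (suc u) w k

leftTurnAt : Bool → ℕ → List Bool → ℕ → Bool
leftTurnAt p d []          j = false
leftTurnAt p d (true ∷ w)  j = (not p ∧ (d ≡ᵇ j)) ∨ leftTurnAt true d w j
leftTurnAt p d (false ∷ w) j = leftTurnAt false (suc d) w j

RightTurnAfter : ∀ {m} → Bool → Vec Bool m → ℕ → Set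
RightTurnAfter p w i =
  nth w i ≡ just false × (i ≡ 0 × p ≡ true ⊎ Σ ℕ λ j → i ≡ suc j × nth w j ≡ just true)

LeftTurnAfter : ∀ {m} → Bool → Vec Bool m → ℕ → Set
LeftTurnAfter p w i =
  nth w i ≡ just true × (i ≡ 0 × p ≡ false ⊎ Σ ℕ λ j → i ≡ suc j × nth w j ≡ just false)

rightTurnAfter-∷ : ∀ {m} p x {w : Vec Bool m} {i} →
                   RightTurnAfter x w i → RightTurnAfter p (x ∷ w) (suc i)
rightTurnAfter-∷ p x (at , inj₁ (refl , refl))   = at , inj₂ (0 , refl , refl)
rightTurnAfter-∷ p x (at , inj₂ (j , refl , bj)) = at , inj₂ (suc j , refl , bj)

rightTurnAfter-∷⁻ : ∀ {m} p x {w : Vec Bool m} {i} →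
                    RightTurnAfter p (x ∷ w) (suc i) → RightTurnAfter x w i
rightTurnAfter-∷⁻ p x (at , inj₂ (zero , refl , bx))  = at , inj₁ (refl , just-injective bx)
rightTurnAfter-∷⁻ p x (at , inj₂ (suc j , refl , bj)) = at , inj₂ (j , refl , bj)

leftTurnAfter-∷ : ∀ {m} p x {w : Vec Bool m} {i} →
                  LeftTurnAfter x w i → LeftTurnAfter p (x ∷ w) (suc i)
leftTurnAfter-∷ p x (at , inj₁ (refl , refl))   = at , inj₂ (0 , refl , refl)
leftTurnAfter-∷ p x (at , inj₂ (j , refl , bj)) = at , inj₂ (suc j , refl , bj)

leftTurnAfter-∷⁻ : ∀ {m} p x {w : Vec Bool m} {i} →
                   LeftTurnAfter p (x ∷ w) (suc i) → LeftTurnAfter x w i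
leftTurnAfter-∷⁻ p x (at , inj₂ (zero , refl , bx))  = at , inj₁ (refl , just-injective bx)
leftTurnAfter-∷⁻ p x (at , inj₂ (suc j , refl , bj)) = at , inj₂ (j , refl , bj)

rightTurnAt-sound : ∀ {m} p u (w : Vec Bool m) k → rightTurnAt p u (toList w) k ≡ true →
                    ∃ λ i → RightTurnAfter p w i × u + ups (take i (toList w)) ≡ k
rightTurnAt-sound p     u (true ∷ w)  k e with rightTurnAt-sound true (suc u) w k e
... | i , turn , count = suc i , rightTurnAfter-∷ p true turn , trans (+-suc u _) count
rightTurnAt-sound false u (false ∷ w) k e with rightTurnAt-sound false u w k e
... | i , turn , count = suc i , rightTurnAfter-∷ false false turn , count
rightTurnAt-sound true  u (false ∷ w) k e with u ≡ᵇ k in u≡ᵇk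
... | true  = 0 , (refl , inj₁ (refl , refl)) , trans (+-identityʳ u) (≡ᵇ≡true⇒≡ u k u≡ᵇk)
... | false with rightTurnAt-sound false u w k e
...   | i , turn , count = suc i , rightTurnAfter-∷ true false turn , count

rightTurnAt-complete : ∀ {m} p u (w : Vec Bool m) k i → RightTurnAfter p w i →
                       u + ups (take i (toList w)) ≡ k → rightTurnAt p u (toList w) k ≡ true
rightTurnAt-complete .true u (false ∷ w) .(u + 0) zero (refl , inj₁ (_ , refl)) refl
  rewrite +-identityʳ u | ≡ᵇ-refl u = refl
rightTurnAt-complete p u (false ∷ w) k (suc i) turn count
  rewrite rightTurnAt-complete false u w k i (rightTurnAfter-∷⁻ p false turn) count =
  ∨-zeroʳ (p ∧ (u ≡ᵇ k))
rightTurnAt-complete p u (true ∷ w) k (suc i) turn count =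
  rightTurnAt-complete true (suc u) w k i (rightTurnAfter-∷⁻ p true turn) (trans (sym (+-suc u _)) count)

leftTurnAt-sound : ∀ {m} p d (w : Vec Bool m) j → leftTurnAt p d (toList w) j ≡ true →
                   ∃ λ i → LeftTurnAfter p w i × d + downs (take i (toList w)) ≡ j
leftTurnAt-sound p     d (false ∷ w) j e with leftTurnAt-sound false (suc d) w j e
... | i , turn , count = suc i , leftTurnAfter-∷ p false turn , trans (+-suc d _) count
leftTurnAt-sound true  d (true ∷ w)  j e with leftTurnAt-sound true d w j e
... | i , turn , count = suc i , leftTurnAfter-∷ true true turn , count
leftTurnAt-sound false d (true ∷ w)  j e with d ≡ᵇ j in d≡ᵇj
... | true  = 0 , (refl , inj₁ (refl , refl)) , trans (+-identityʳ d) (≡ᵇ≡true⇒≡ d j d≡ᵇj)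
... | false with leftTurnAt-sound true d w j e
...   | i , turn , count = suc i , leftTurnAfter-∷ false true turn , count

leftTurnAt-complete : ∀ {m} p d (w : Vec Bool m) j i → LeftTurnAfter p w i →
                      d + downs (take i (toList w)) ≡ j → leftTurnAt p d (toList w) j ≡ true
leftTurnAt-complete .false d (true ∷ w) .(d + 0) zero (refl , inj₁ (_ , refl)) refl
  rewrite +-identityʳ d | ≡ᵇ-refl d = refl
leftTurnAt-complete p d (true ∷ w) j (suc i) turn count
  rewrite leftTurnAt-complete true d w j i (leftTurnAfter-∷⁻ p true turn) count =
  ∨-zeroʳ (not p ∧ (d ≡ᵇ j))
leftTurnAt-complete p d (false ∷ w) j (suc i) turn count =
  leftTurnAt-complete false (suc d) w j i (leftTurnAfter-∷⁻ p false turn) (trans (sym (+-suc d _)) count)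

nth≡just⇒< : ∀ {m} (w : Vec Bool m) i {x} → nth w i ≡ just x → i < m
nth≡just⇒< (y ∷ w) zero    _ = s≤s z≤n
nth≡just⇒< (y ∷ w) (suc i) e = s≤s (nth≡just⇒< w i e)

+[2*m]≡+[2*n]⇒m≡n : ∀ {m n} → + (2 * m) ≡ + (2 * n) → m ≡ n
+[2*m]≡+[2*n]⇒m≡n {m} {n} e = *-cancelˡ-≡ m n 2 (ℤ.+-injective e)

rightTurnAt⇔RightTurn : ∀ {m} (w : Vec Bool m) k →
  rightTurnAt true 0 (toList w) k ≡ true ⇔ ∃ λ i → RightTurn w i × + i ℤ.+ height w i ≡ + (2 * k)
rightTurnAt⇔RightTurn w k = mk⇔ to from
  where
  to : rightTurnAt true 0 (toList w) k ≡ true → ∃ λ i → RightTurn w i × + i ℤ.+ height w i ≡ + (2 * k)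
  to e with rightTurnAt-sound true 0 w k e
  ... | i , (at , before) , count =
    i , (at , map₁ proj₁ before) ,
    trans (i+height≡2*ups w i (<⇒≤ (nth≡just⇒< w i at))) (cong (λ u → + (2 * u)) count)
  from : (∃ λ i → RightTurn w i × + i ℤ.+ height w i ≡ + (2 * k)) → rightTurnAt true 0 (toList w) k ≡ true
  from (i , (at , before) , ih) =
    rightTurnAt-complete true 0 w k i (at , map₁ (_, refl) before)
      (+[2*m]≡+[2*n]⇒m≡n (trans (sym (i+height≡2*ups w i (<⇒≤ (nth≡just⇒< w i at)))) ih))

leftTurnAt⇔LeftTurn : ∀ {m} (w : Vec Bool m) j →
  leftTurnAt true 0 (toList w) j ≡ true ⇔ ∃ λ i → LeftTurn w i × + i ℤ.- height w i ≡ + (2 * j)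
leftTurnAt⇔LeftTurn w j = mk⇔ to from
  where
  to : leftTurnAt true 0 (toList w) j ≡ true → ∃ λ i → LeftTurn w i × + i ℤ.- height w i ≡ + (2 * j)
  to e with leftTurnAt-sound true 0 w j e
  ... | i , (at , inj₂ (i′ , i≡1+i′ , before)) , count =
    i , (i′ , i≡1+i′ , before , at) ,
    trans (i-height≡2*downs w i (<⇒≤ (nth≡just⇒< w i at))) (cong (λ d → + (2 * d)) count)
  from : (∃ λ i → LeftTurn w i × + i ℤ.- height w i ≡ + (2 * j)) → leftTurnAt true 0 (toList w) j ≡ true
  from (i , (i′ , i≡1+i′ , before , at) , ih) =
    leftTurnAt-complete true 0 w j i (at , inj₂ (i′ , i≡1+i′ , before))
      (+[2*m]≡+[2*n]⇒m≡n (trans (sym (i-height≡2*downs w i (<⇒≤ (nth≡just⇒< w i at)))) ih))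

record CheckmarkIndicators {n} (q : Path n) (A : Vec Bool n) (B : Vec Bool (n ∸ 1)) : Set where
  constructor indicators
  field
    nw : ∀ k → lookup A k ≡ rightTurnAt true 0 (toList (word q)) (toℕ k)
    sw : ∀ k → lookup B k ≡ leftTurnAt true 0 (toList (word q)) (suc (toℕ k))

isCheckmarkRep⇔indicators : ∀ {n} (q : Path n) A B → IsCheckmarkRep q A B ⇔ CheckmarkIndicators q A B
isCheckmarkRep⇔indicators q A B = mk⇔ to from
  where
  R = λ (k : Fin _) → rightTurnAt⇔RightTurn (word q) (toℕ k)
  L = λ (k : Fin _) → leftTurnAt⇔LeftTurn (word q) (suc (toℕ k))
  to : IsCheckmarkRep q A B → CheckmarkIndicators q A B
  to (nw , sw) = indicators
    (λ k → ⇔→≡ (⇔.trans (mk⇔ (proj₁ (nw k)) (proj₂ (nw k))) (⇔.sym (R k))))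
    (λ k → ⇔→≡ (⇔.trans (mk⇔ (proj₁ (sw k)) (proj₂ (sw k))) (⇔.sym (L k))))
  from : CheckmarkIndicators q A B → IsCheckmarkRep q A B
  from (indicators nw sw) =
    (λ k → (λ e → Equivalence.to (R k) (trans (sym (nw k)) e)) , (λ t → trans (nw k) (Equivalence.from (R k) t))) ,
    (λ k → (λ e → Equivalence.to (L k) (trans (sym (sw k)) e)) , (λ t → trans (sw k) (Equivalence.from (L k) t)))

rightTurnAt-< : ∀ p u w k → k < u → rightTurnAt p u w k ≡ false
rightTurnAt-< p u []          k k<u = refl
rightTurnAt-< p u (false ∷ w) k k<u
  rewrite ≢⇒≡ᵇ≡false u k (λ u≡k → <⇒≢ k<u (sym u≡k)) | ∧-zeroʳ p = rightTurnAt-< false u w k k<u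
rightTurnAt-< p u (true ∷ w)  k k<u = rightTurnAt-< true (suc u) w k (m<n⇒m<1+n k<u)

leftTurnAt-< : ∀ p d w j → j < d → leftTurnAt p d w j ≡ false
leftTurnAt-< p d []          j j<d = refl
leftTurnAt-< p d (true ∷ w)  j j<d
  rewrite ≢⇒≡ᵇ≡false d j (λ d≡j → <⇒≢ j<d (sym d≡j)) | ∧-zeroʳ (not p) = leftTurnAt-< true d w j j<d
leftTurnAt-< p d (false ∷ w) j j<d = leftTurnAt-< false (suc d) w j (m<n⇒m<1+n j<d)

rightTurnAt-noDown : ∀ p u w k → downs w ≡ 0 → rightTurnAt p u w k ≡ false
rightTurnAt-noDown p u []         k _ = refl
rightTurnAt-noDown p u (true ∷ w) k e = rightTurnAt-noDown true (suc u) w k e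

leftTurnAt-noUp : ∀ p d w j → ups w ≡ 0 → leftTurnAt p d w j ≡ false
leftTurnAt-noUp p d []          j _ = refl
leftTurnAt-noUp p d (false ∷ w) j e = leftTurnAt-noUp false (suc d) w j e

rightTurnAt-∷-down : ∀ u w k → u < k → rightTurnAt true u (false ∷ w) k ≡ rightTurnAt false u w k
rightTurnAt-∷-down u w k u<k rewrite ≢⇒≡ᵇ≡false u k (<⇒≢ u<k) = refl

leftTurnAt-∷-up : ∀ d w j → d < j → leftTurnAt false d (true ∷ w) j ≡ leftTurnAt true d w j
leftTurnAt-∷-up d w j d<j rewrite ≢⇒≡ᵇ≡false d j (<⇒≢ d<j) = refl

-- Reading a word off its turns

CheckmarkLists : List Bool → List Bool → Set
CheckmarkLists nw sw = ups nw ≡ ups sw ⊎ ups nw ≡ suc (ups sw)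

checkmarkLists-[]ˡ : ∀ sw → CheckmarkLists [] sw → ups sw ≡ 0
checkmarkLists-[]ˡ sw (inj₁ e) = sym e

checkmarkLists-[]ʳ : ∀ nw → CheckmarkLists (true ∷ nw) [] → ups nw ≡ 0
checkmarkLists-[]ʳ nw (inj₂ e) = suc-injective e

checkmarkLists-∷ : ∀ nw sw → CheckmarkLists (true ∷ nw) (true ∷ sw) → CheckmarkLists nw sw
checkmarkLists-∷ nw sw = Sum.map suc-injective suc-injective

-- decodeU continues the reading after an up-step (or at the start), decodeD after a
-- down-step; nw and sw are the NW and SW entries not yet used.  An exhausted list means that
-- the current step is the last of its kind, so the rest is forced.
decodeU : List Bool → List Bool → List Bool
decodeD : List Bool → List Bool → List Bool
decodeU []           sw = replicate (suc (length sw)) false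
decodeU (false ∷ nw) sw = true ∷ decodeU nw sw
decodeU (true ∷ nw)  sw = false ∷ decodeD nw sw
decodeD nw []           = replicate (suc (length nw)) true
decodeD nw (false ∷ sw) = false ∷ decodeD nw sw
decodeD nw (true ∷ sw)  = true ∷ decodeU nw sw

mutual
  counts-decodeU : ∀ nw sw → ups (decodeU nw sw) ≡ length nw × downs (decodeU nw sw) ≡ suc (length sw)
  counts-decodeU []           sw = ups-replicate-false (suc (length sw)) , downs-replicate-false (suc (length sw))
  counts-decodeU (false ∷ nw) sw = Prod.map₁ (cong suc) (counts-decodeU nw sw)
  counts-decodeU (true ∷ nw)  sw = Prod.map₂ (cong suc) (counts-decodeD nw sw)

  counts-decodeD : ∀ nw sw → ups (decodeD nw sw) ≡ suc (length nw) × downs (decodeD nw sw) ≡ length sw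
  counts-decodeD nw []           = ups-replicate-true (suc (length nw)) , downs-replicate-true (suc (length nw))
  counts-decodeD nw (false ∷ sw) = Prod.map₂ (cong suc) (counts-decodeD nw sw)
  counts-decodeD nw (true ∷ sw)  = Prod.map₁ (cong suc) (counts-decodeU nw sw)

mutual
  rightTurnAt-decodeU : ∀ nw sw u → CheckmarkLists nw sw → ∀ k → k < length nw →
                        rightTurnAt true u (decodeU nw sw) (u + k) ≡ stepAt nw k
  rightTurnAt-decodeU (false ∷ nw) sw u cl zero _ =
    rightTurnAt-< true (suc u) (decodeU nw sw) (u + 0) (s≤s (≤-reflexive (+-identityʳ u)))
  rightTurnAt-decodeU (false ∷ nw) sw u cl (suc k) (s≤s k<) =
    trans (cong (rightTurnAt true (suc u) (decodeU nw sw)) (+-suc u k)) (rightTurnAt-decodeU nw sw (suc u) cl k k<)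
  rightTurnAt-decodeU (true ∷ nw) sw u cl zero _ rewrite +-identityʳ u | ≡ᵇ-refl u = refl
  rightTurnAt-decodeU (true ∷ nw) sw u cl (suc k) (s≤s k<)
    rewrite ≢⇒≡ᵇ≡false u (u + suc k) (λ e → m≢1+m+n u (trans e (+-suc u k))) | +-suc u k =
    rightTurnAt-decodeD nw sw u cl k k<

  rightTurnAt-decodeD : ∀ nw sw u → CheckmarkLists (true ∷ nw) sw → ∀ k → k < length nw →
                        rightTurnAt false u (decodeD nw sw) (suc u + k) ≡ stepAt nw k
  rightTurnAt-decodeD nw [] u cl k _ =
    trans (rightTurnAt-noDown false u (replicate (suc (length nw)) true) _ (downs-replicate-true (suc (length nw))))
          (sym (ups≡0⇒stepAt≡false nw k (checkmarkLists-[]ʳ nw cl)))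
  rightTurnAt-decodeD nw (false ∷ sw) u cl k k< = rightTurnAt-decodeD nw sw u cl k k<
  rightTurnAt-decodeD nw (true ∷ sw)  u cl k k< =
    rightTurnAt-decodeU nw sw (suc u) (checkmarkLists-∷ nw sw cl) k k<

mutual
  leftTurnAt-decodeU : ∀ nw sw d → CheckmarkLists nw sw → ∀ j → j < length sw →
                       leftTurnAt true d (decodeU nw sw) (suc d + j) ≡ stepAt sw j
  leftTurnAt-decodeU [] sw d cl j _ =
    trans (leftTurnAt-noUp true d (replicate (suc (length sw)) false) _ (ups-replicate-false (suc (length sw))))
          (sym (ups≡0⇒stepAt≡false sw j (checkmarkLists-[]ˡ sw cl)))
  leftTurnAt-decodeU (false ∷ nw) sw d cl j j< = leftTurnAt-decodeU nw sw d cl j j<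
  leftTurnAt-decodeU (true ∷ nw)  sw d cl j j< = leftTurnAt-decodeD nw sw (suc d) cl j j<

  leftTurnAt-decodeD : ∀ nw sw d → CheckmarkLists (true ∷ nw) sw → ∀ j → j < length sw →
                       leftTurnAt false d (decodeD nw sw) (d + j) ≡ stepAt sw j
  leftTurnAt-decodeD nw (false ∷ sw) d cl zero _ =
    leftTurnAt-< false (suc d) (decodeD nw sw) (d + 0) (s≤s (≤-reflexive (+-identityʳ d)))
  leftTurnAt-decodeD nw (false ∷ sw) d cl (suc j) (s≤s j<) =
    trans (cong (leftTurnAt false (suc d) (decodeD nw sw)) (+-suc d j)) (leftTurnAt-decodeD nw sw (suc d) cl j j<)
  leftTurnAt-decodeD nw (true ∷ sw) d cl zero _ rewrite +-identityʳ d | ≡ᵇ-refl d = refl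
  leftTurnAt-decodeD nw (true ∷ sw) d cl (suc j) (s≤s j<)
    rewrite ≢⇒≡ᵇ≡false d (d + suc j) (λ e → m≢1+m+n d (trans e (+-suc d j))) | +-suc d j =
    leftTurnAt-decodeU nw sw d (checkmarkLists-∷ nw sw cl) j j<

peaksAfter : Bool → List Bool → ℕ
peaksAfter p []          = bit p
peaksAfter p (false ∷ w) = bit p + peaksAfter false w
peaksAfter p (true ∷ w)  = peaksAfter true w

peaksAfter-replicate : ∀ x m → peaksAfter x (replicate m x) ≡ bit x
peaksAfter-replicate x     zero    = refl
peaksAfter-replicate true  (suc m) = peaksAfter-replicate true m
peaksAfter-replicate false (suc m) = peaksAfter-replicate false m

mutual
  peaksAfter-decodeU : ∀ nw sw → CheckmarkLists nw sw → peaksAfter true (decodeU nw sw) ≡ suc (ups nw)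
  peaksAfter-decodeU []           sw cl = cong suc (peaksAfter-replicate false (length sw))
  peaksAfter-decodeU (false ∷ nw) sw cl = peaksAfter-decodeU nw sw cl
  peaksAfter-decodeU (true ∷ nw)  sw cl = cong suc (peaksAfter-decodeD nw sw cl)

  peaksAfter-decodeD : ∀ nw sw → CheckmarkLists (true ∷ nw) sw → peaksAfter false (decodeD nw sw) ≡ suc (ups nw)
  peaksAfter-decodeD nw []           cl =
    trans (peaksAfter-replicate true (length nw)) (cong suc (sym (checkmarkLists-[]ʳ nw cl)))
  peaksAfter-decodeD nw (false ∷ sw) cl = peaksAfter-decodeD nw sw cl
  peaksAfter-decodeD nw (true ∷ sw)  cl = peaksAfter-decodeU nw sw (checkmarkLists-∷ nw sw cl)

mutual
  decodeU-turns : ∀ w u d e → downs w ≡ suc e →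
    w ≡ decodeU (slice (rightTurnAt true u w) u (ups w)) (slice (leftTurnAt true d w) (suc d) e)
  decodeU-turns (true ∷ w) u d e de
    rewrite rightTurnAt-< true (suc u) w u (n<1+n u) = cong (true ∷_) (decodeU-turns w (suc u) d e de)
  decodeU-turns (false ∷ w) u d .(downs w) refl with ups w in upsw
  ... | zero = trans (cong (false ∷_) (ups≡0⇒replicate w upsw))
                     (cong (λ m → replicate (suc m) false) (sym (length-slice _ (suc d) (downs w))))
  ... | suc c rewrite ≡ᵇ-refl u =
    cong (false ∷_) (trans (decodeD-turns w u (suc d) c upsw)
      (cong (λ nw → decodeD nw (slice (leftTurnAt false (suc d) w) (suc d) (downs w)))
            (sym (slice-cong (rightTurnAt true u (false ∷ w)) (rightTurnAt false u w) (suc u) c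
                             (λ k → rightTurnAt-∷-down u w k)))))

  decodeD-turns : ∀ w u d c → ups w ≡ suc c →
    w ≡ decodeD (slice (rightTurnAt false u w) (suc u) c) (slice (leftTurnAt false d w) d (downs w))
  decodeD-turns (false ∷ w) u d c uc
    rewrite leftTurnAt-< false (suc d) w d (n<1+n d) = cong (false ∷_) (decodeD-turns w u (suc d) c uc)
  decodeD-turns (true ∷ w) u d .(ups w) refl with downs w in downsw
  ... | zero = trans (cong (true ∷_) (downs≡0⇒replicate w downsw))
                     (cong (λ m → replicate (suc m) true) (sym (length-slice _ (suc u) (ups w))))
  ... | suc e rewrite ≡ᵇ-refl d =
    cong (true ∷_) (trans (decodeU-turns w (suc u) d e downsw)
      (cong (decodeU (slice (rightTurnAt true (suc u) w) (suc u) (ups w)))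
            (sym (slice-cong (leftTurnAt false d (true ∷ w)) (leftTurnAt true d w) (suc d) e
                             (λ j → leftTurnAt-∷-up d w j)))))

-- Right and left turns alternate.
mutual
  turnCountsU : ∀ w u d →
    ups (slice (rightTurnAt true u w) u (ups w)) ≡ ups (slice (leftTurnAt true d w) (suc d) (downs w))
  turnCountsU []          u d = refl
  turnCountsU (true ∷ w)  u d rewrite rightTurnAt-< true (suc u) w u (n<1+n u) = turnCountsU w (suc u) d
  turnCountsU (false ∷ w) u d with ups w in upsw
  ... | zero = sym (ups-slice-false (leftTurnAt false (suc d) w) (suc d) (suc (downs w))
                                    (λ j → leftTurnAt-noUp false (suc d) w j upsw))
  ... | suc c rewrite ≡ᵇ-refl u =
    trans (cong (λ nw → suc (ups nw))
                (slice-cong (rightTurnAt true u (false ∷ w)) (rightTurnAt false u w) (suc u) c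
                            (λ k → rightTurnAt-∷-down u w k)))
          (turnCountsD w u (suc d) c upsw)

  turnCountsD : ∀ w u d c → ups w ≡ suc c →
    suc (ups (slice (rightTurnAt false u w) (suc u) c)) ≡ ups (slice (leftTurnAt false d w) d (suc (downs w)))
  turnCountsD (false ∷ w) u d c uc
    rewrite leftTurnAt-< false (suc d) w d (n<1+n d) = turnCountsD w u (suc d) c uc
  turnCountsD (true ∷ w) u d .(ups w) refl rewrite ≡ᵇ-refl d =
    cong suc (trans (turnCountsU w (suc u) d)
      (cong ups (sym (slice-cong (leftTurnAt false d (true ∷ w)) (leftTurnAt true d w) (suc d) (downs w)
                                 (λ j → leftTurnAt-∷-up d w j)))))

-- Checkmark representations of paths

ups-word : ∀ {n} (p : Path n) → ups (toList (word p)) ≡ n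
ups-word {n} p = Equivalence.to (closed⇔ups≡n n (word p)) (closed p)

downs-word : ∀ {n} (p : Path n) → downs (toList (word p)) ≡ n
downs-word {n} p = +-cancelˡ-≡ n _ _ (begin
  n + downs w        ≡⟨ cong (_+ downs w) (ups-word p) ⟨
  ups w + downs w    ≡⟨ length≡ups+downs w ⟨
  length w           ≡⟨ length-toList (word p) ⟩
  2 * n              ≡⟨ cong (_+_ n) (+-identityʳ n) ⟩
  n + n              ∎)
  where
  open ≡-Reasoning
  w = toList (word p)

listPath : ∀ n (w : List Bool) → length w ≡ 2 * n → ups w ≡ n → Path n
listPath n w len u =
  path (fromList′ w len) (Equivalence.from (closed⇔ups≡n n _) (trans (cong ups (toList-fromList′ w len)) u))

path-≡ : ∀ {n} {p q : Path n} → toList (word p) ≡ toList (word q) → p ≡ q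
path-≡ {p = path w c} {path w′ c′} e with trans (sym (cast-is-id refl w)) (toList-injective refl w w′ e)
... | refl = cong (path w) (Decidable⇒UIP.≡-irrelevant ℤ._≟_ c c′)

interiorPeaks+lastUp : ∀ x xs → interiorPeaks (x ∷ xs) + lastUp (x ∷ xs) ≡ peaksAfter x xs
interiorPeaks+lastUp true  []           = refl
interiorPeaks+lastUp false []           = refl
interiorPeaks+lastUp true  (true ∷ xs)  = interiorPeaks+lastUp true xs
interiorPeaks+lastUp true  (false ∷ xs) = cong suc (interiorPeaks+lastUp false xs)
interiorPeaks+lastUp false (true ∷ xs)  = interiorPeaks+lastUp true xs
interiorPeaks+lastUp false (false ∷ xs) = interiorPeaks+lastUp false xs

peaks≡peaksAfter : ∀ {n′} (q : Path (suc n′)) → peaks q ≡ peaksAfter true (toList (word q))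
peaks≡peaksAfter (path (true ∷ v) _)  = interiorPeaks+lastUp true (toList v)
peaks≡peaksAfter (path (false ∷ v) _) = cong suc (interiorPeaks+lastUp false (toList v))

checkmarkPair⇒lists : ∀ {m} (A : Vec Bool m) (B : Vec Bool (m ∸ 1)) →
  CheckmarkPair A B → CheckmarkLists (toList A) (toList B)
checkmarkPair⇒lists A B = Sum.map (λ e → trans (sym (arrows≡ups A)) (trans e (arrows≡ups B)))
                                  (λ e → trans (sym (arrows≡ups A)) (trans e (cong suc (arrows≡ups B))))

module _ {n′ : ℕ} where

  word≡decodeU : (q : Path (suc n′)) (A : Vec Bool (suc n′)) (B : Vec Bool n′) →
                 CheckmarkIndicators q A B → toList (word q) ≡ decodeU (toList A) (toList B)
  word≡decodeU q A B (indicators nw sw) = begin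
    w                                            ≡⟨ decodeU-turns w 0 0 n′ (downs-word q) ⟩
    decodeU (slice r 0 (ups w)) (slice l 1 n′)   ≡⟨ cong (λ m → decodeU (slice r 0 m) (slice l 1 n′)) (ups-word q) ⟩
    decodeU (slice r 0 (suc n′)) (slice l 1 n′)  ≡⟨ cong₂ decodeU (toList≡slice A r 0 nw) (toList≡slice B l 1 sw) ⟨
    decodeU (toList A) (toList B)                ∎
    where
    open ≡-Reasoning
    w = toList (word q)
    r = rightTurnAt true 0 w
    l = leftTurnAt true 0 w

  indicators-injective : ∀ {q q′ : Path (suc n′)} {A B} →
    CheckmarkIndicators q A B → CheckmarkIndicators q′ A B → q ≡ q′
  indicators-injective {q} {q′} {A} {B} ind ind′ =
    path-≡ (trans (word≡decodeU q A B ind) (sym (word≡decodeU q′ A B ind′)))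

  indicators-unique : ∀ {q : Path (suc n′)} {A A′ B B′} →
    CheckmarkIndicators q A B → CheckmarkIndicators q A′ B′ → A ≡ A′ × B ≡ B′
  indicators-unique (indicators nw sw) (indicators nw′ sw′) =
    lookup-ext _ _ (λ k → trans (nw k) (sym (nw′ k))) , lookup-ext _ _ (λ k → trans (sw k) (sym (sw′ k)))

  indicators-checkmarkPair : ∀ (q : Path (suc n′)) A B → CheckmarkIndicators q A B → CheckmarkPair A B
  indicators-checkmarkPair q A B (indicators nw sw) = ≡+bit⇒⊎ (l (suc n′)) (begin
    arrows A                              ≡⟨ arrows≡ups A ⟩
    ups (toList A)                        ≡⟨ cong ups (toList≡slice A r 0 nw) ⟩
    ups (slice r 0 (suc n′))              ≡⟨ cong (λ m → ups (slice r 0 m)) (ups-word q) ⟨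
    ups (slice r 0 (ups w))               ≡⟨ turnCountsU w 0 0 ⟩
    ups (slice l 1 (downs w))             ≡⟨ cong (λ m → ups (slice l 1 m)) (downs-word q) ⟩
    ups (slice l 1 (suc n′))              ≡⟨ cong ups (slice-∷ʳ l 1 n′) ⟩
    ups (slice l 1 n′ ++ [ l (suc n′) ])  ≡⟨ ups-∷ʳ (slice l 1 n′) (l (suc n′)) ⟩
    ups (slice l 1 n′) + bit (l (suc n′)) ≡⟨ cong (λ m → ups m + bit (l (suc n′))) (toList≡slice B l 1 sw) ⟨
    ups (toList B) + bit (l (suc n′))     ≡⟨ cong (_+ bit (l (suc n′))) (arrows≡ups B) ⟨
    arrows B + bit (l (suc n′))           ∎)
    where
    open ≡-Reasoning
    w = toList (word q)
    r = rightTurnAt true 0 w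
    l = leftTurnAt true 0 w

  decodePath : Vec Bool (suc n′) → Vec Bool n′ → Path (suc n′)
  decodePath A B = listPath (suc n′) (decodeU (toList A) (toList B)) len ups-A
    where
    a = toList A
    b = toList B
    ups-A : ups (decodeU a b) ≡ suc n′
    ups-A = trans (proj₁ (counts-decodeU a b)) (length-toList A)
    downs-A : downs (decodeU a b) ≡ suc n′
    downs-A = trans (proj₂ (counts-decodeU a b)) (cong suc (length-toList B))
    len : length (decodeU a b) ≡ 2 * suc n′
    len = begin
      length (decodeU a b)                        ≡⟨ length≡ups+downs (decodeU a b) ⟩
      ups (decodeU a b) + downs (decodeU a b)     ≡⟨ cong₂ _+_ ups-A downs-A ⟩
      suc n′ + suc n′                             ≡⟨ cong (_+_ (suc n′)) (+-identityʳ (suc n′)) ⟨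
      2 * suc n′                                  ∎
      where open ≡-Reasoning

  toList-decodePath : ∀ A B → toList (word (decodePath A B)) ≡ decodeU (toList A) (toList B)
  toList-decodePath A B = toList-fromList′ (decodeU (toList A) (toList B)) _

  decodePath-indicators : ∀ A B → CheckmarkPair A B → CheckmarkIndicators (decodePath A B) A B
  decodePath-indicators A B cp = indicators
    (λ k → trans (lookup≡stepAt A k) (sym (trans
      (cong (λ w → rightTurnAt true 0 w (toℕ k)) decoded)
      (rightTurnAt-decodeU a b 0 cl (toℕ k) (toℕ<length-toList A k)))))
    (λ k → trans (lookup≡stepAt B k) (sym (trans
      (cong (λ w → leftTurnAt true 0 w (suc (toℕ k))) decoded)
      (leftTurnAt-decodeU a b 0 cl (toℕ k) (toℕ<length-toList B k)))))
    where
    a = toList A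
    b = toList B
    cl = checkmarkPair⇒lists A B cp
    decoded = toList-decodePath A B

  peaks-indicators : ∀ (q : Path (suc n′)) A B → CheckmarkPair A B → CheckmarkIndicators q A B →
                     peaks q ≡ suc (arrows A)
  peaks-indicators q A B cp ind = begin
    peaks q                                          ≡⟨ peaks≡peaksAfter q ⟩
    peaksAfter true (toList (word q))                ≡⟨ cong (peaksAfter true) (word≡decodeU q A B ind) ⟩
    peaksAfter true (decodeU (toList A) (toList B))
      ≡⟨ peaksAfter-decodeU (toList A) (toList B) (checkmarkPair⇒lists A B cp) ⟩
    suc (ups (toList A))                             ≡⟨ cong suc (arrows≡ups A) ⟨
    suc (arrows A)                                   ∎
    where open ≡-Reasoning

-- The pair (s_NW, s_SW)

double : ℕ → ℕ
double zero    = zero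
double (suc n) = suc (suc (double n))

double≡2* : ∀ n → double n ≡ 2 * n
double≡2* zero    = refl
double≡2* (suc n) = trans (cong (λ m → suc (suc m)) (double≡2* n)) (sym (*-suc 2 n))

double-cancel-< : ∀ m n → double m < double n → m < n
double-cancel-< zero    (suc n) _              = s≤s z≤n
double-cancel-< (suc m) (suc n) (s≤s (s≤s lt)) = s≤s (double-cancel-< m n lt)

even⊎odd : ∀ i → ∃ λ k → i ≡ double k ⊎ i ≡ suc (double k)
even⊎odd zero    = 0 , inj₁ refl
even⊎odd (suc i) with even⊎odd i
... | k , inj₁ e = k , inj₂ (cong suc e)
... | k , inj₂ e = suc k , inj₁ (cong suc e)

evenStep oddStep : List Bool → ℕ → Bool
evenStep w j = stepAt w (double j)
oddStep  w j = stepAt w (suc (double j))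

lookup-sNW : ∀ {n} (p : Path n) k → lookup (sNW p) k ≡ not (evenStep (toList (word p)) (toℕ k))
lookup-sNW p k = trans (lookup∘tabulate _ k) (cong not (trans (lookup≡stepAt (word p) _)
  (cong (stepAt (toList (word p))) (trans (toℕ-fromℕ< _) (sym (double≡2* (toℕ k)))))))

lookup-sSW : ∀ {n} (p : Path n) k → lookup (sSW p) k ≡ oddStep (toList (word p)) (toℕ k)
lookup-sSW p k = trans (lookup∘tabulate _ k) (trans (lookup≡stepAt (word p) _)
  (cong (stepAt (toList (word p))) (trans (toℕ-fromℕ< _) (cong suc (sym (double≡2* (toℕ k)))))))

length-word : ∀ {n} (p : Path n) → length (toList (word p)) ≡ double n
length-word {n} p = trans (length-toList (word p)) (sym (double≡2* n))

ups-not-slice : ∀ f s c → ups (slice (λ j → not (f j)) s c) + ups (slice f s c) ≡ c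
ups-not-slice f s zero    = refl
ups-not-slice f s (suc c) with f s
... | true  = trans (+-suc _ _) (cong suc (ups-not-slice f (suc s) c))
... | false = cong suc (ups-not-slice f (suc s) c)

ups-even+odd : ∀ c w → length w ≡ double c →
               ups (slice (evenStep w) 0 c) + ups (slice (oddStep w) 0 c) ≡ ups w
ups-even+odd zero    []          _ = refl
ups-even+odd (suc c) (x ∷ y ∷ w) len
  rewrite slice-suc (evenStep (x ∷ y ∷ w)) 0 c | slice-suc (oddStep (x ∷ y ∷ w)) 0 c =
  trans (interchange (bit x) (bit y) _ _)
        (cong (λ u → bit x + (bit y + u)) (ups-even+odd c w (suc-injective (suc-injective len))))
  where
  interchange : ∀ a b e o → (a + e) + (b + o) ≡ a + (b + (e + o))
  interchange = ℕ-Solver.solve-∀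

module _ {n′ : ℕ} (p : Path (suc n′)) where
  private
    w = toList (word p)

  toList-sNW : toList (sNW p) ≡ slice (λ j → not (evenStep w j)) 0 (suc n′)
  toList-sNW = toList≡slice (sNW p) _ 0 (lookup-sNW p)

  toList-sSW : toList (sSW p) ≡ slice (oddStep w) 0 n′
  toList-sSW = toList≡slice (sSW p) _ 0 (lookup-sSW p)

  arrows-sNW≡ups-odd : arrows (sNW p) ≡ ups (slice (oddStep w) 0 (suc n′))
  arrows-sNW≡ups-odd = +-cancelʳ-≡ _ _ _ (begin
    arrows (sNW p) + E                                  ≡⟨ cong (_+ E) (trans (arrows≡ups (sNW p)) (cong ups toList-sNW)) ⟩
    ups (slice (λ j → not (evenStep w j)) 0 (suc n′)) + E ≡⟨ ups-not-slice (evenStep w) 0 (suc n′) ⟩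
    suc n′                                              ≡⟨ ups-word p ⟨
    ups w                                               ≡⟨ ups-even+odd (suc n′) w (length-word p) ⟨
    E + O                                               ≡⟨ +-comm E O ⟩
    O + E                                               ∎)
    where
    open ≡-Reasoning
    E = ups (slice (evenStep w) 0 (suc n′))
    O = ups (slice (oddStep w) 0 (suc n′))

  checkmarkPair-s : CheckmarkPair (sNW p) (sSW p)
  checkmarkPair-s = ≡+bit⇒⊎ (oddStep w n′) (begin
    arrows (sNW p)                               ≡⟨ arrows-sNW≡ups-odd ⟩
    ups (slice (oddStep w) 0 (suc n′))           ≡⟨ cong ups (slice-∷ʳ (oddStep w) 0 n′) ⟩
    ups (slice (oddStep w) 0 n′ ++ [ last ])     ≡⟨ ups-∷ʳ (slice (oddStep w) 0 n′) last ⟩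
    ups (slice (oddStep w) 0 n′) + bit last      ≡⟨ cong (_+ bit last) (trans (arrows≡ups (sSW p)) (cong ups toList-sSW)) ⟨
    arrows (sSW p) + bit last                    ∎)
    where
    open ≡-Reasoning
    last = oddStep w n′

weave : List Bool → List Bool → Bool → List Bool
weave []       _        _ = []
weave (a ∷ as) []       z = not a ∷ z ∷ []
weave (a ∷ as) (b ∷ bs) z = not a ∷ b ∷ weave as bs z

length-weave : ∀ as bs z → length as ≡ suc (length bs) → length (weave as bs z) ≡ double (length as)
length-weave (a ∷ [])  []       z _   = refl
length-weave (a ∷ as) (b ∷ bs) z len = cong (λ m → suc (suc m)) (length-weave as bs z (suc-injective len))

ups-weave : ∀ as bs z → length as ≡ suc (length bs) → ups (weave as bs z) ≡ downs as + (ups bs + bit z)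
ups-weave (a ∷ [])  []       z _   = cong₂ _+_ (sym (+-identityʳ (bit (not a)))) (+-identityʳ (bit z))
ups-weave (a ∷ as) (b ∷ bs) z len =
  trans (cong (λ u → bit (not a) + (bit b + u)) (ups-weave as bs z (suc-injective len)))
        (interchange (bit (not a)) (bit b) (downs as) (ups bs) (bit z))
  where
  interchange : ∀ a b d u z → a + (b + (d + (u + z))) ≡ (a + d) + ((b + u) + z)
  interchange = ℕ-Solver.solve-∀

evenStep-weave : ∀ as bs z → length as ≡ suc (length bs) → ∀ k → k < length as →
                 evenStep (weave as bs z) k ≡ not (stepAt as k)
evenStep-weave (a ∷ [])  []       z _   zero    _        = refl
evenStep-weave (a ∷ [])  []       z _   (suc k) (s≤s ())
evenStep-weave (a ∷ as) (b ∷ bs) z _   zero    _        = refl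
evenStep-weave (a ∷ as) (b ∷ bs) z len (suc k) (s≤s lt) = evenStep-weave as bs z (suc-injective len) k lt

oddStep-weave : ∀ as bs z → length as ≡ suc (length bs) → ∀ k → k < length bs →
                oddStep (weave as bs z) k ≡ stepAt bs k
oddStep-weave (a ∷ as) (b ∷ bs) z _   zero    _        = refl
oddStep-weave (a ∷ as) (b ∷ bs) z len (suc k) (s≤s lt) = oddStep-weave as bs z (suc-injective len) k lt

sNW-sSW-surjective : ∀ {n′} (A : Vec Bool (suc n′)) (B : Vec Bool n′) → CheckmarkPair A B →
                     ∃ λ (p : Path (suc n′)) → sNW p ≡ A × sSW p ≡ B
sNW-sSW-surjective {n′} A B cp with ⊎⇒≡+bit cp
... | z , arrowsA = p , lookup-ext _ _ nw , lookup-ext _ _ sw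
  where
  as = toList A
  bs = toList B
  len : length as ≡ suc (length bs)
  len = trans (length-toList A) (cong suc (sym (length-toList B)))
  w = weave as bs z
  upsW : ups w ≡ suc n′
  upsW = begin
    ups w                           ≡⟨ ups-weave as bs z len ⟩
    downs as + (ups bs + bit z)     ≡⟨ cong (λ u → downs as + (u + bit z)) (arrows≡ups B) ⟨
    downs as + (arrows B + bit z)   ≡⟨ cong (_+_ (downs as)) arrowsA ⟨
    downs as + arrows A             ≡⟨ cong (_+_ (downs as)) (arrows≡ups A) ⟩
    downs as + ups as               ≡⟨ +-comm (downs as) (ups as) ⟩
    ups as + downs as               ≡⟨ length≡ups+downs as ⟨
    length as                       ≡⟨ length-toList A ⟩
    suc n′                          ∎
    where open ≡-Reasoning
  p : Path (suc n′)
  p = listPath (suc n′) w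
        (trans (length-weave as bs z len) (trans (cong double (length-toList A)) (double≡2* (suc n′)))) upsW
  toList-p : toList (word p) ≡ w
  toList-p = toList-fromList′ w _
  nw : ∀ k → lookup (sNW p) k ≡ lookup A k
  nw k = begin
    lookup (sNW p) k                            ≡⟨ lookup-sNW p k ⟩
    not (evenStep (toList (word p)) (toℕ k))    ≡⟨ cong (λ u → not (evenStep u (toℕ k))) toList-p ⟩
    not (evenStep w (toℕ k))                    ≡⟨ cong not (evenStep-weave as bs z len (toℕ k) (toℕ<length-toList A k)) ⟩
    not (not (stepAt as (toℕ k)))               ≡⟨ not-involutive _ ⟩
    stepAt as (toℕ k)                           ≡⟨ lookup≡stepAt A k ⟨
    lookup A k                                  ∎
    where open ≡-Reasoning
  sw : ∀ k → lookup (sSW p) k ≡ lookup B k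
  sw k = begin
    lookup (sSW p) k                            ≡⟨ lookup-sSW p k ⟩
    oddStep (toList (word p)) (toℕ k)           ≡⟨ cong (λ u → oddStep u (toℕ k)) toList-p ⟩
    oddStep w (toℕ k)                           ≡⟨ oddStep-weave as bs z len (toℕ k) (toℕ<length-toList B k) ⟩
    stepAt bs (toℕ k)                           ≡⟨ lookup≡stepAt B k ⟨
    lookup B k                                  ∎
    where open ≡-Reasoning

init-ups-injective : ∀ w w′ → length w ≡ length w′ → ups w ≡ ups w′ →
                     (∀ i → suc i < length w → stepAt w i ≡ stepAt w′ i) → w ≡ w′
init-ups-injective []          []            _   _ _ = refl
init-ups-injective (x ∷ [])    (x′ ∷ [])     _   u _ =
  cong [_] (bit-injective x x′ (trans (sym (+-identityʳ _)) (trans u (+-identityʳ _))))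
  where
  bit-injective : ∀ x x′ → bit x ≡ bit x′ → x ≡ x′
  bit-injective true  true  _ = refl
  bit-injective false false _ = refl
init-ups-injective (x ∷ y ∷ w) (x′ ∷ y′ ∷ w′) len u agree =
  cong₂ _∷_ x≡x′ (init-ups-injective (y ∷ w) (y′ ∷ w′) (suc-injective len)
                   (+-cancelˡ-≡ (bit x) _ _ (trans u (cong (λ b → bit b + ups (y′ ∷ w′)) (sym x≡x′))))
                   (λ i lt → agree (suc i) (s≤s lt)))
  where
  x≡x′ : x ≡ x′
  x≡x′ = agree 0 (s≤s (s≤s z≤n))

sNW-sSW-injective : ∀ {n′} {p p′ : Path (suc n′)} → sNW p ≡ sNW p′ → sSW p ≡ sSW p′ → p ≡ p′
sNW-sSW-injective {n′} {p} {p′} nw sw =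
  path-≡ (init-ups-injective w w′ (trans (length-word p) (sym (length-word p′)))
                             (trans (ups-word p) (sym (ups-word p′))) agree)
  where
  w  = toList (word p)
  w′ = toList (word p′)
  evens : ∀ k → k < suc n′ → evenStep w k ≡ evenStep w′ k
  evens k lt = subst (λ j → evenStep w j ≡ evenStep w′ j) (toℕ-fromℕ< lt)
    (not-injective (trans (sym (lookup-sNW p (fromℕ< lt)))
                   (trans (cong (λ v → lookup v (fromℕ< lt)) nw) (lookup-sNW p′ (fromℕ< lt)))))
  odds : ∀ k → k < n′ → oddStep w k ≡ oddStep w′ k
  odds k lt = subst (λ j → oddStep w j ≡ oddStep w′ j) (toℕ-fromℕ< lt)
    (trans (sym (lookup-sSW p (fromℕ< lt)))
           (trans (cong (λ v → lookup v (fromℕ< lt)) sw) (lookup-sSW p′ (fromℕ< lt))))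
  agree : ∀ i → suc i < length w → stepAt w i ≡ stepAt w′ i
  agree i lt with even⊎odd i | subst (suc i <_) (length-word p) lt
  ... | k , inj₁ refl | lt′ = evens k (double-cancel-< k (suc n′) (m<n⇒m<1+n (s≤s⁻¹ lt′)))
  ... | k , inj₂ refl | lt′ = odds k (double-cancel-< k n′ (s≤s⁻¹ (s≤s⁻¹ lt′)))

-- The bi-banded weight

even : ℕ → Bool
even zero          = true
even (suc zero)    = false
even (suc (suc m)) = even m

even-suc : ∀ m → even (suc m) ≡ not (even m)
even-suc zero    = refl
even-suc (suc m) = trans (sym (not-involutive (even m))) (cong not (sym (even-suc m)))

%2≡ : ∀ m → m % 2 ≡ (if even m then 0 else 1)
%2≡ zero          = refl
%2≡ (suc zero)    = refl
%2≡ (suc (suc m)) = %2≡ m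

isEven≡even : ∀ z → isEven z ≡ even ∣ z ∣
isEven≡even z with even ∣ z ∣ | %2≡ ∣ z ∣
... | true  | e rewrite e = refl
... | false | e rewrite e = refl

isEven-+1 : ∀ h → isEven (h ℤ.+ + 1) ≡ not (isEven h)
isEven-+1 (+ m) rewrite isEven≡even (+ (m + 1)) | isEven≡even (+ m) | +-comm m 1 = even-suc m
isEven-+1 -[1+ zero ]  = refl
isEven-+1 -[1+ suc m ] rewrite isEven≡even -[1+ m ] | isEven≡even -[1+ suc m ] = even-suc m

isEven-−1 : ∀ h → isEven (h ℤ.- + 1) ≡ not (isEven h)
isEven-−1 h = begin
  isEven (h ℤ.- + 1)                         ≡⟨ not-involutive _ ⟨
  not (not (isEven (h ℤ.- + 1)))             ≡⟨ cong not (isEven-+1 (h ℤ.- + 1)) ⟨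
  not (isEven ((h ℤ.- + 1) ℤ.+ + 1))         ≡⟨ cong (λ z → not (isEven z)) (cancel h) ⟩
  not (isEven h)                             ∎
  where
  open ≡-Reasoning
  cancel : ∀ h → (h ℤ.- + 1) ℤ.+ + 1 ≡ h
  cancel = ℤ-Solver.solve-∀

-- The b-steps (up from an odd, down from an even height) of a word starting at a height of
-- parity e, with true for even.
bSteps : Bool → List Bool → ℕ
bSteps e []       = 0
bSteps e (x ∷ xs) = bit (e xor x) + bSteps (not e) xs

biBanded-bSteps : ∀ h xs → proj₂ (biBandedFrom h xs) ≡ bSteps (isEven h) xs
biBanded-bSteps h [] = refl
biBanded-bSteps h (true ∷ xs)
  with biBandedFrom (h ℤ.+ + 1) xs | biBanded-bSteps (h ℤ.+ + 1) xs | isEven h | isEven-+1 h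
... | _ | ih | true  | e = trans ih (cong (λ b → bSteps b xs) e)
... | _ | ih | false | e = cong suc (trans ih (cong (λ b → bSteps b xs) e))
biBanded-bSteps h (false ∷ xs)
  with biBandedFrom (h ℤ.- + 1) xs | biBanded-bSteps (h ℤ.- + 1) xs | isEven h | isEven-−1 h
... | _ | ih | true  | e = cong suc (trans ih (cong (λ b → bSteps b xs) e))
... | _ | ih | false | e = trans ih (cong (λ b → bSteps b xs) e)

bSteps≡ups-even+odd : ∀ c w → length w ≡ double c →
  bSteps true w ≡ ups (slice (λ j → not (evenStep w j)) 0 c) + ups (slice (oddStep w) 0 c)
bSteps≡ups-even+odd zero    []          _ = refl
bSteps≡ups-even+odd (suc c) (x ∷ y ∷ w) len
  rewrite slice-suc (λ j → not (evenStep (x ∷ y ∷ w) j)) 0 c | slice-suc (oddStep (x ∷ y ∷ w)) 0 c =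
  trans (cong (λ u → bit (not x) + (bit y + u)) (bSteps≡ups-even+odd c w (suc-injective (suc-injective len))))
        (sym (interchange (bit (not x)) (bit y) _ _))
  where
  interchange : ∀ a b e o → (a + e) + (b + o) ≡ a + (b + (e + o))
  interchange = ℕ-Solver.solve-∀

bSteps≡2*arrows-sNW : ∀ {n′} (p : Path (suc n′)) → bSteps true (toList (word p)) ≡ 2 * arrows (sNW p)
bSteps≡2*arrows-sNW {n′} p = begin
  bSteps true w                                            ≡⟨ bSteps≡ups-even+odd (suc n′) w (length-word p) ⟩
  ups (slice (λ j → not (evenStep w j)) 0 (suc n′)) + ups (slice (oddStep w) 0 (suc n′))
    ≡⟨ cong₂ _+_ (trans (arrows≡ups (sNW p)) (cong ups (toList-sNW p))) (arrows-sNW≡ups-odd p) ⟨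
  arrows (sNW p) + arrows (sNW p)                          ≡⟨ cong (_+_ (arrows (sNW p))) (+-identityʳ _) ⟨
  2 * arrows (sNW p)                                       ∎
  where
  open ≡-Reasoning
  w = toList (word p)

-- The map φ

module _ {n′ : ℕ} where

  turnsNW : Path (suc n′) → Vec Bool (suc n′)
  turnsNW q = tabulate (λ k → rightTurnAt true 0 (toList (word q)) (toℕ k))

  turnsSW : Path (suc n′) → Vec Bool n′
  turnsSW q = tabulate (λ k → leftTurnAt true 0 (toList (word q)) (suc (toℕ k)))

  turns-indicators : ∀ q → CheckmarkIndicators q (turnsNW q) (turnsSW q)
  turns-indicators q = indicators (lookup∘tabulate _) (lookup∘tabulate _)

  φ₀ : Path (suc n′) → Path (suc n′)
  φ₀ p = decodePath (sNW p) (sSW p)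

  φ₀-rep : ∀ p → IsCheckmarkRep (φ₀ p) (sNW p) (sSW p)
  φ₀-rep p = Equivalence.from (isCheckmarkRep⇔indicators (φ₀ p) (sNW p) (sSW p))
                              (decodePath-indicators (sNW p) (sSW p) (checkmarkPair-s p))

  module _ (φ : Path (suc n′) → Path (suc n′))
           (rep : ∀ p → IsCheckmarkRep (φ p) (sNW p) (sSW p)) where

    φ-indicators : ∀ p → CheckmarkIndicators (φ p) (sNW p) (sSW p)
    φ-indicators p = Equivalence.to (isCheckmarkRep⇔indicators (φ p) (sNW p) (sSW p)) (rep p)

    φ-injective : Injective _≡_ _≡_ φ
    φ-injective {p} {p′} φp≡φp′ = sNW-sSW-injective (proj₁ same) (proj₂ same)
      where
      ind′ : CheckmarkIndicators (φ p) (sNW p′) (sSW p′)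
      ind′ = subst (λ q → CheckmarkIndicators q (sNW p′) (sSW p′)) (sym φp≡φp′) (φ-indicators p′)
      same = indicators-unique (φ-indicators p) ind′

    φ-strictlySurjective : StrictlySurjective _≡_ φ
    φ-strictlySurjective q = p , indicators-injective indφp (turns-indicators q)
      where
      realised : ∃ λ p → sNW p ≡ turnsNW q × sSW p ≡ turnsSW q
      realised = sNW-sSW-surjective (turnsNW q) (turnsSW q)
                   (indicators-checkmarkPair q (turnsNW q) (turnsSW q) (turns-indicators q))
      p : Path (suc n′)
      p = proj₁ realised
      indφp : CheckmarkIndicators (φ p) (turnsNW q) (turnsSW q)
      indφp = subst₂ (CheckmarkIndicators (φ p)) (proj₁ (proj₂ realised)) (proj₂ (proj₂ realised))
                     (φ-indicators p)

    φ-peaks : ∀ p v → biBanded p ≡ (2 * suc n′ ∸ 2 * v , 2 * v) → peaks (φ p) ≡ suc v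
    φ-peaks p v bb = trans (peaks-indicators (φ p) (sNW p) (sSW p) (checkmarkPair-s p) (φ-indicators p))
                           (cong suc (*-cancelˡ-≡ _ v 2 (begin
                              2 * arrows (sNW p)               ≡⟨ bSteps≡2*arrows-sNW p ⟨
                              bSteps true (toList (word p))    ≡⟨ biBanded-bSteps (+ 0) (toList (word p)) ⟨
                              proj₂ (biBanded p)               ≡⟨ cong proj₂ bb ⟩
                              2 * v                            ∎)))
      where open ≡-Reasoning

theorem1 : (n : ℕ) → 1 ≤ n →
    ((p : Path n) → CheckmarkPair (sNW p) (sSW p))
    × Σ (Path n → Path n) (λ φ → (p : Path n) → IsCheckmarkRep (φ p) (sNW p) (sSW p))
    × ((φ : Path n → Path n) → ((p : Path n) → IsCheckmarkRep (φ p) (sNW p) (sSW p)) →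
        Bijective _≡_ _≡_ φ
        × ((p : Path n) (v : ℕ) → biBanded p ≡ (2 * n ∸ 2 * v , 2 * v) →
            peaks (φ p) ≡ suc v))
theorem1 zero    ()
theorem1 (suc n′) _ =
  checkmarkPair-s ,
  (φ₀ , φ₀-rep) ,
  λ φ rep → (φ-injective φ rep , strictlySurjective⇒surjective (φ-strictlySurjective φ rep)) , φ-peaks φ rep
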